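{- Let $P$ be an HCP process and let $\mathcal{G}$, $\mathcal{G}'$ be hyperenvironments. If $\vdash P :: \mathcal{G}$ is derivable, $P \Vdash \mathrm{strip}(\mathcal{G}')$ is derivable, and $\mathcal{G}$ and $\mathcal{G}'$ are shufflings of each other, then $\vdash P :: \mathcal{G}'$ is derivable.
   Context: HCP processes (names $x,y,z,\dots$) are generated by: $x[y].P$ (output, binds $y$ in $P$), $x(y).P$ (input, binds $y$), $x[].P$, $x().P$, $x[\mathsf{inl}].P$, $x[\mathsf{inr}].P$, $x.\mathsf{case}(P,Q)$, $!x(y).P$ (binds $y$), $?x[y].P$ (binds $y$), $?x[x_1,x_2].P$ (binds $x_1,x_2$), $?x[].P$, $(\nu xy)P$ (binds $x,y$), $P \mid Q$, $\mathbf{0}$, $[x\leftrightarrow y]$; processes are considered up to $\alpha$-conversion. Types: $A,B ::= A\otimes B \mid A \mathbin{⅋} B \mid A\oplus B \mid A \,\&\, B \mid 1 \mid \bot \mid ?A \mid !A$, with the involutive duality $A^\perp$ given by $(A\otimes B)^\perp = A^\perp ⅋ B^\perp$, $(A\oplus B)^\perp = A^\perp \& B^\perp$, $1^\perp=\bot$, $(?A)^\perp = !A^\perp$ and symmetrically. An environment $\Gamma$ is an unordered finite list $x_1:A_1,\dots,x_n:A_n$ of distinct names with types ($\bullet$ empty); $\Gamma,\Delta$ presupposes disjoint names. A hyperenvironment $\mathcal{G} = \Gamma_1 \mid \cdots \mid \Gamma_n$ is an unordered collection of environments with all names distinct ($\varnothing$ empty); $\mathcal{G}\mid\mathcal{H}$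 presupposes disjoint names. $?\Gamma$ denotes an environment all of whose types have the form $?B$. Typing judgements $\vdash P :: \mathcal{G}$ are derived by the rules: (Ax) $\vdash [x\leftrightarrow y] :: x:A^\perp, y:A$; (H-Cut) from $\vdash P :: \mathcal{G}\mid \Gamma,x:A \mid \Delta, y:A^\perp$ infer $\vdash (\nu xy)P :: \mathcal{G}\mid\Gamma,\Delta$; (H-Mix) from $\vdash P::\mathcal{G}$ and $\vdash Q::\mathcal{H}$ infer $\vdash P\mid Q :: \mathcal{G}\mid\mathcal{H}$; (H-Mix$_0$) $\vdash \mathbf{0}::\varnothing$; ($\otimes$) from $\vdash P :: \mathcal{G}\mid\Gamma,y:A\mid\Delta,x:B$ infer $\vdash x[y].P :: \mathcal{G}\mid\Gamma,\Delta,x:A\otimes B$; ($1$) from $\vdash P::\mathcal{G}$ infer $\vdash x[].P :: \mathcal{G}\mid x:1$; (⅋) from $\vdash P :: \mathcal{G}\mid\Gamma,y:A,x:B$ infer $\vdash x(y).P :: \mathcal{G}\mid\Gamma, x:A⅋B$; ($\bot$) from $\vdash P::\mathcal{G}\mid\Gamma$ infer $\vdash x().P :: \mathcal{G}\mid\Gamma,x:\bot$; ($\oplus_1$) from $\vdash P::\mathcal{G}\mid\Gamma,x:A$ infer $\vdash x[\mathsf{inl}].P :: \mathcal{G}\mid\Gamma,x:A\oplus B$; ($\oplus_2$) from $\vdash P::\mathcal{G}\mid\Gamma,x:B$ infer $\vdash x[\mathsf{inr}].P :: \mathcal{G}\mid\Gamma,x:A\oplus B$; ($\&$) from $\vdash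 P::\Gamma,x:A$ and $\vdash Q::\Gamma,x:B$ infer $\vdash x.\mathsf{case}(P,Q)::\Gamma,x:A\&B$; ($!$) from $\vdash P :: ?\Gamma, y:A$ infer $\vdash !x(y).P :: ?\Gamma, x:!A$; ($?$) from $\vdash P::\mathcal{G}\mid\Gamma,y:A$ infer $\vdash ?x[y].P :: \mathcal{G}\mid\Gamma,x:?A$; (W) from $\vdash P::\mathcal{G}\mid\Gamma$ infer $\vdash ?x[].P::\mathcal{G}\mid\Gamma,x:?A$; (C) from $\vdash P::\mathcal{G}\mid\Gamma,x':?A,x'':?A$ infer $\vdash ?x[x',x''].P::\mathcal{G}\mid\Gamma,x:?A$. Partition judgements $P \Vdash G$, where $G$ is a hyperenvironment of bare names (no types), are derived by the same rules with all types and type constraints erased and $\vdash$ replaced by $\Vdash$. $\mathrm{strip}(\mathcal{G})$ is the name partition obtained by erasing types from $\mathcal{G}$. Two hyperenvironments $\mathcal{G},\mathcal{G}'$ are shufflings of each other if they contain the same number of non-empty environments and, for all $x$ and $A$, $x:A$ occurs in $\mathcal{G}$ iff $x:A$ occurs in $\mathcal{G}'$. -}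

module Defs where

open import Data.Nat using (ℕ)
open import Data.List using (List; []; _∷_; _++_; map; concat; length)
open import Data.Product using (_×_; _,_; proj₁; proj₂; ∃)
open import Relation.Binary.PropositionalEquality using (_≡_)
open import Data.List.Relation.Unary.All using (All)
open import Data.List.Relation.Unary.Any using (Any)
open import Data.List.Membership.Propositional using (_∈_)
open import Data.List.Relation.Unary.Unique.Propositional using (Unique)
open import Data.List.Relation.Binary.Permutation.Propositional using (_↭_)
open import Data.List.Relation.Binary.Permutation.Homogeneous using (Permutation)
open import Function.Bundles using (_⇔_)

Name : Set
Name = ℕ

data Proc : Set where
  out   : Name → Name → Proc → Proc
  inp   : Name → Name → Proc → Proc
  close : Name → Proc → Proc
  wait  : Name → Proc → Proc
  sel-inl : Name → Proc → Proc
  sel-inr : Name → Proc → Proc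
  case  : Name → Proc → Proc → Proc
  srv   : Name → Name → Proc → Proc
  cli   : Name → Name → Proc → Proc
  cntr  : Name → Name → Name → Proc → Proc
  weak  : Name → Proc → Proc
  res   : Name → Name → Proc → Proc
  par   : Proc → Proc → Proc
  nil   : Proc
  fwd   : Name → Name → Proc

data Type : Set where
  _⊗_ _⅋_ _⊕_ _&_ : Type → Type → Type
  𝟙 ⊥ₜ : Type
  ‼_ ⁇_ : Type → Type

_^⊥ : Type → Type
(A ⊗ B) ^⊥ = (A ^⊥) ⅋ (B ^⊥)
(A ⅋ B) ^⊥ = (A ^⊥) ⊗ (B ^⊥)
(A ⊕ B) ^⊥ = (A ^⊥) & (B ^⊥)
(A & B) ^⊥ = (A ^⊥) ⊕ (B ^⊥)
𝟙 ^⊥ = ⊥ₜ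
⊥ₜ ^⊥ = 𝟙
(‼ A) ^⊥ = ⁇ (A ^⊥)
(⁇ A) ^⊥ = ‼ (A ^⊥)

-- Environments and hyperenvironments (lists, taken up to the
-- equivalence ≈H below, which makes them unordered collections)

Env : Set
Env = List (Name × Type)

HEnv : Set
HEnv = List Env

NEnv : Set
NEnv = List Name

NHEnv : Set
NHEnv = List NEnv

WhyNotEnv : Env → Set
WhyNotEnv Γ = All (λ p → ∃ λ B → proj₂ p ≡ ⁇ B) Γ

dropEmpty : {X : Set} → List (List X) → List (List X)
dropEmpty [] = []
dropEmpty ([] ∷ G) = dropEmpty G
dropEmpty ((x ∷ Γ) ∷ G) = (x ∷ Γ) ∷ dropEmpty G

_≈H_ : {X : Set} → List (List X) → List (List X) → Set
G ≈H G' = Permutation _↭_ (dropEmpty G) (dropEmpty G')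

namesH : HEnv → List Name
namesH G = concat (map (map proj₁) G)

WF : HEnv → Set
WF G = Unique (namesH G)

WFN : NHEnv → Set
WFN G = Unique (concat G)

infix 4 ⊢_∷_ _⊩_

data ⊢_∷_ : Proc → HEnv → Set where
  t-exch : ∀ {P G G'} → ⊢ P ∷ G → G ≈H G' → ⊢ P ∷ G'
  t-ax   : ∀ {x y A} → WF (((x , A ^⊥) ∷ (y , A) ∷ []) ∷ []) →
           ⊢ fwd x y ∷ (((x , A ^⊥) ∷ (y , A) ∷ []) ∷ [])
  t-cut  : ∀ {P G Γ Δ x y A} → WF ((Γ ++ Δ) ∷ G) →
           ⊢ P ∷ (((x , A) ∷ Γ) ∷ ((y , A ^⊥) ∷ Δ) ∷ G) →
           ⊢ res x y P ∷ ((Γ ++ Δ) ∷ G)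
  t-mix  : ∀ {P Q G H} → WF (G ++ H) →
           ⊢ P ∷ G → ⊢ Q ∷ H → ⊢ par P Q ∷ (G ++ H)
  t-mix0 : ⊢ nil ∷ []
  t-⊗    : ∀ {P G Γ Δ x y A B} → WF ((Γ ++ Δ ++ ((x , A ⊗ B) ∷ [])) ∷ G) →
           ⊢ P ∷ (((y , A) ∷ Γ) ∷ ((x , B) ∷ Δ) ∷ G) →
           ⊢ out x y P ∷ ((Γ ++ Δ ++ ((x , A ⊗ B) ∷ [])) ∷ G)
  t-𝟙    : ∀ {P G x} → WF (((x , 𝟙) ∷ []) ∷ G) →
           ⊢ P ∷ G → ⊢ close x P ∷ (((x , 𝟙) ∷ []) ∷ G)
  t-⅋    : ∀ {P G Γ x y A B} → WF (((x , A ⅋ B) ∷ Γ) ∷ G) →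
           ⊢ P ∷ (((y , A) ∷ (x , B) ∷ Γ) ∷ G) →
           ⊢ inp x y P ∷ (((x , A ⅋ B) ∷ Γ) ∷ G)
  t-⊥    : ∀ {P G Γ x} → WF (((x , ⊥ₜ) ∷ Γ) ∷ G) →
           ⊢ P ∷ (Γ ∷ G) → ⊢ wait x P ∷ (((x , ⊥ₜ) ∷ Γ) ∷ G)
  t-⊕₁   : ∀ {P G Γ x A B} → WF (((x , A ⊕ B) ∷ Γ) ∷ G) →
           ⊢ P ∷ (((x , A) ∷ Γ) ∷ G) → ⊢ sel-inl x P ∷ (((x , A ⊕ B) ∷ Γ) ∷ G)
  t-⊕₂   : ∀ {P G Γ x A B} → WF (((x , A ⊕ B) ∷ Γ) ∷ G) →
           ⊢ P ∷ (((x , B) ∷ Γ) ∷ G) → ⊢ sel-inr x P ∷ (((x , A ⊕ B) ∷ Γ) ∷ G)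
  t-&    : ∀ {P Q Γ x A B} → WF (((x , A & B) ∷ Γ) ∷ []) →
           ⊢ P ∷ (((x , A) ∷ Γ) ∷ []) → ⊢ Q ∷ (((x , B) ∷ Γ) ∷ []) →
           ⊢ case x P Q ∷ (((x , A & B) ∷ Γ) ∷ [])
  t-!    : ∀ {P Γ x y A} → WF (((x , ‼ A) ∷ Γ) ∷ []) → WhyNotEnv Γ →
           ⊢ P ∷ (((y , A) ∷ Γ) ∷ []) → ⊢ srv x y P ∷ (((x , ‼ A) ∷ Γ) ∷ [])
  t-?    : ∀ {P G Γ x y A} → WF (((x , ⁇ A) ∷ Γ) ∷ G) →
           ⊢ P ∷ (((y , A) ∷ Γ) ∷ G) → ⊢ cli x y P ∷ (((x , ⁇ A) ∷ Γ) ∷ G)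
  t-W    : ∀ {P G Γ x A} → WF (((x , ⁇ A) ∷ Γ) ∷ G) →
           ⊢ P ∷ (Γ ∷ G) → ⊢ weak x P ∷ (((x , ⁇ A) ∷ Γ) ∷ G)
  t-C    : ∀ {P G Γ x x₁ x₂ A} → WF (((x , ⁇ A) ∷ Γ) ∷ G) →
           ⊢ P ∷ (((x₁ , ⁇ A) ∷ (x₂ , ⁇ A) ∷ Γ) ∷ G) →
           ⊢ cntr x x₁ x₂ P ∷ (((x , ⁇ A) ∷ Γ) ∷ G)

-- Partition judgement  P ⊩ G  (types and type constraints erased)

data _⊩_ : Proc → NHEnv → Set where
  p-exch : ∀ {P G G'} → P ⊩ G → G ≈H G' → P ⊩ G'
  p-ax   : ∀ {x y} → WFN ((x ∷ y ∷ []) ∷ []) → fwd x y ⊩ ((x ∷ y ∷ []) ∷ [])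
  p-cut  : ∀ {P G Γ Δ x y} → WFN ((Γ ++ Δ) ∷ G) →
           P ⊩ ((x ∷ Γ) ∷ (y ∷ Δ) ∷ G) → res x y P ⊩ ((Γ ++ Δ) ∷ G)
  p-mix  : ∀ {P Q G H} → WFN (G ++ H) → P ⊩ G → Q ⊩ H → par P Q ⊩ (G ++ H)
  p-mix0 : nil ⊩ []
  p-⊗    : ∀ {P G Γ Δ x y} → WFN ((Γ ++ Δ ++ (x ∷ [])) ∷ G) →
           P ⊩ ((y ∷ Γ) ∷ (x ∷ Δ) ∷ G) → out x y P ⊩ ((Γ ++ Δ ++ (x ∷ [])) ∷ G)
  p-𝟙    : ∀ {P G x} → WFN ((x ∷ []) ∷ G) → P ⊩ G → close x P ⊩ ((x ∷ []) ∷ G)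
  p-⅋    : ∀ {P G Γ x y} → WFN ((x ∷ Γ) ∷ G) →
           P ⊩ ((y ∷ x ∷ Γ) ∷ G) → inp x y P ⊩ ((x ∷ Γ) ∷ G)
  p-⊥    : ∀ {P G Γ x} → WFN ((x ∷ Γ) ∷ G) → P ⊩ (Γ ∷ G) → wait x P ⊩ ((x ∷ Γ) ∷ G)
  p-⊕₁   : ∀ {P G Γ x} → WFN ((x ∷ Γ) ∷ G) → P ⊩ ((x ∷ Γ) ∷ G) → sel-inl x P ⊩ ((x ∷ Γ) ∷ G)
  p-⊕₂   : ∀ {P G Γ x} → WFN ((x ∷ Γ) ∷ G) → P ⊩ ((x ∷ Γ) ∷ G) → sel-inr x P ⊩ ((x ∷ Γ) ∷ G)
  p-&    : ∀ {P Q Γ x} → WFN ((x ∷ Γ) ∷ []) →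
           P ⊩ ((x ∷ Γ) ∷ []) → Q ⊩ ((x ∷ Γ) ∷ []) → case x P Q ⊩ ((x ∷ Γ) ∷ [])
  p-!    : ∀ {P Γ x y} → WFN ((x ∷ Γ) ∷ []) → P ⊩ ((y ∷ Γ) ∷ []) → srv x y P ⊩ ((x ∷ Γ) ∷ [])
  p-?    : ∀ {P G Γ x y} → WFN ((x ∷ Γ) ∷ G) → P ⊩ ((y ∷ Γ) ∷ G) → cli x y P ⊩ ((x ∷ Γ) ∷ G)
  p-W    : ∀ {P G Γ x} → WFN ((x ∷ Γ) ∷ G) → P ⊩ (Γ ∷ G) → weak x P ⊩ ((x ∷ Γ) ∷ G)
  p-C    : ∀ {P G Γ x x₁ x₂} → WFN ((x ∷ Γ) ∷ G) →
           P ⊩ ((x₁ ∷ x₂ ∷ Γ) ∷ G) → cntr x x₁ x₂ P ⊩ ((x ∷ Γ) ∷ G)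

strip : HEnv → NHEnv
strip G = map (map proj₁) G

_∈H_ : Name × Type → HEnv → Set
p ∈H G = Any (p ∈_) G

Shuffling : HEnv → HEnv → Set
Shuffling G G' = (length (dropEmpty G) ≡ length (dropEmpty G'))
               × (∀ x A → ((x , A) ∈H G) ⇔ ((x , A) ∈H G'))

-- A well-formed hyperenvironment G gives each of its names a single type, so it
-- determines an assignment τ : Name → Type agreeing with G. A shuffling G' has the same
-- entries, so τ agrees with G' as well, and G' is recovered from strip G' by annotating
-- every name with its τ-type. It therefore suffices that P ⊩ H and ⊢ P ∷ G, with τ
-- agreeing with G, give ⊢ P ∷ annotateH τ H. This goes by simultaneous induction on both
-- derivations: exchanges on either side are absorbed, and otherwise both end with the rule
-- dictated by the head of P. Its premise is retyped with τ updated at the names whose type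
-- changes there (the bound names, and the subject of ⊗, ⅋, ⊕, &); these are fresh for the
-- rest of the premise, so nothing else moves. The !-rule needs ?-types on its context:
-- every name of a partition of P is a name of every typing of P, so τ gives the context
-- names the ?-types they have in the typing derivation.

module Submission where

open import Defs

open import Data.Nat using (_≟_)
open import Data.List using (List; []; _∷_; _++_; [_]; map; concat)
open import Data.List.Properties
  using ( map-++; map-∘; map-cong; map-id; map-cong-local; map-id-local
        ; concat-map; concat-++; ++-assoc)
open import Data.Product using (_×_; _,_; proj₁; proj₂; ∃)
open import Function using (_∘_)
open import Function.Bundles using (Equivalence)
open import Relation.Nullary using (yes; no)
open import Data.Empty using (⊥-elim)
open import Relation.Binary.PropositionalEquality
  using (_≡_; _≢_; refl; sym; trans; cong; cong₂; subst; subst₂; setoid)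
open import Data.List.Relation.Unary.Any using (here; there)
open import Data.List.Relation.Unary.All as All using (All; []; _∷_; lookup; tabulate)
open import Data.List.Relation.Unary.All.Properties
  using (++⁺; ++⁻ˡ; ++⁻ʳ; concat⁺; concat⁻; map⁺; All¬⇒¬Any)
open import Data.List.Relation.Unary.AllPairs using (head; tail; []; _∷_)
open import Data.List.Relation.Unary.Unique.Propositional using (Unique)
open import Data.List.Membership.Propositional using (_∈_)
open import Data.List.Membership.Propositional.Properties using (∈-concat⁺; ∈-concat⁻)
open import Data.List.Relation.Binary.Subset.Propositional using (_⊆_)
open import Data.List.Relation.Binary.Subset.Propositional.Properties
  using (⊆-refl; ⊆-trans; ⊆-respˡ-↭; ⊆-respʳ-↭; ∷⁺ʳ; ⊆∷∧∉⇒⊆; xs⊆xs++ys)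
import Data.List.Relation.Binary.Subset.Propositional.Properties as ⊆
open import Data.List.Relation.Binary.Permutation.Propositional
  using (_↭_; ↭-sym; ↭-trans; ↭-reflexive; prep; ↭-setoid; ↭⇒↭ₛ)
open import Data.List.Relation.Binary.Permutation.Propositional.Properties
  using (shift; ++-isCommutativeMonoid)
import Data.List.Relation.Binary.Permutation.Propositional.Properties as ↭
import Data.List.Relation.Binary.Permutation.Setoid.Properties as SetoidPermutation
open import Data.List.Relation.Binary.Permutation.Homogeneous using (Permutation)

private
  variable
    X Y : Set
    v : X
    xs ys : List X
    xss yss : List (List X)
    x y z : Name
    A B : Type
    Γ Δ : Env
    Γn Δn : NEnv
    G G′ : HEnv
    H : NHEnv
    P : Proc

Unique-resp-↭ : {X : Set} {xs ys : List X} → xs ↭ ys → Unique xs → Unique ys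
Unique-resp-↭ {X} = SetoidPermutation.Unique-resp-↭ (setoid X) ∘ ↭⇒↭ₛ

Unique⇒middle-fresh : Unique (xs ++ v ∷ ys) → All (v ≢_) (xs ++ ys)
Unique⇒middle-fresh {xs = xs} {v} {ys} u = head (Unique-resp-↭ (shift v xs ys) u)

shift-middle : (xs ys zs : List X) (v : X) → xs ++ v ∷ ys ++ zs ↭ v ∷ (xs ++ ys) ++ zs
shift-middle xs ys zs v =
  ↭-trans (shift v xs (ys ++ zs)) (prep v (↭-reflexive (sym (++-assoc xs ys zs))))

shift-end : (xs ys zs : List X) (v : X) → (xs ++ ys ++ [ v ]) ++ zs ↭ v ∷ (xs ++ ys) ++ zs
shift-end xs ys zs v = ↭-trans (↭-reflexive reassociate) (shift v (xs ++ ys) zs)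
  where
  reassociate : (xs ++ ys ++ [ v ]) ++ zs ≡ (xs ++ ys) ++ v ∷ zs
  reassociate = trans (++-assoc xs (ys ++ [ v ]) zs)
                (trans (cong (xs ++_) (++-assoc ys [ v ] zs)) (sym (++-assoc xs ys (v ∷ zs))))

⊆-unbind : Unique (v ∷ xs) → v ∷ xs ⊆ v ∷ ys → xs ⊆ ys
⊆-unbind u sub = ⊆∷∧∉⇒⊆ (sub ∘ there) (All¬⇒¬Any (head u))

concat-dropEmpty : (xss : List (List X)) → concat (dropEmpty xss) ≡ concat xss
concat-dropEmpty []             = refl
concat-dropEmpty ([] ∷ xss)     = concat-dropEmpty xss
concat-dropEmpty ((x ∷ xs) ∷ xss) = cong ((x ∷ xs) ++_) (concat-dropEmpty xss)

dropEmpty-map : (f : X → Y) (xss : List (List X)) →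
  dropEmpty (map (map f) xss) ≡ map (map f) (dropEmpty xss)
dropEmpty-map f []               = refl
dropEmpty-map f ([] ∷ xss)       = dropEmpty-map f xss
dropEmpty-map f ((x ∷ xs) ∷ xss) = cong (map f (x ∷ xs) ∷_) (dropEmpty-map f xss)

≈H-concat : (xss yss : List (List X)) → xss ≈H yss → concat xss ↭ concat yss
≈H-concat xss yss p = subst₂ _↭_ (concat-dropEmpty xss) (concat-dropEmpty yss)
  (SetoidPermutation.foldr-commMonoid ↭-setoid ++-isCommutativeMonoid p)

≈H-map : (f : X → Y) (xss yss : List (List X)) →
  xss ≈H yss → map (map f) xss ≈H map (map f) yss
≈H-map f xss yss p =
  subst₂ (Permutation _↭_) (sym (dropEmpty-map f xss)) (sym (dropEmpty-map f yss))
    (SetoidPermutation.map⁺ ↭-setoid ↭-setoid (↭.map⁺ f) p)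

⊩-wf : P ⊩ H → WFN H
⊩-wf (p-exch {G = H} {H′} ⊩P e) = Unique-resp-↭ (≈H-concat H H′ e) (⊩-wf ⊩P)
⊩-wf (p-ax w)     = w
⊩-wf (p-cut w _)  = w
⊩-wf (p-mix w _ _) = w
⊩-wf p-mix0       = []
⊩-wf (p-⊗ w _)    = w
⊩-wf (p-𝟙 w _)    = w
⊩-wf (p-⅋ w _)    = w
⊩-wf (p-⊥ w _)    = w
⊩-wf (p-⊕₁ w _)   = w
⊩-wf (p-⊕₂ w _)   = w
⊩-wf (p-& w _ _)  = w
⊩-wf (p-! w _)    = w
⊩-wf (p-? w _)    = w
⊩-wf (p-W w _)    = w
⊩-wf (p-C w _)    = w

⊢-wf : ⊢ P ∷ G → WF G
⊢-wf (t-exch {G = G} {G′} ⊢P e) =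
  Unique-resp-↭ (≈H-concat (strip G) (strip G′) (≈H-map proj₁ G G′ e)) (⊢-wf ⊢P)
⊢-wf (t-ax w)      = w
⊢-wf (t-cut w _)   = w
⊢-wf (t-mix w _ _) = w
⊢-wf t-mix0        = []
⊢-wf (t-⊗ w _)     = w
⊢-wf (t-𝟙 w _)     = w
⊢-wf (t-⅋ w _)     = w
⊢-wf (t-⊥ w _)     = w
⊢-wf (t-⊕₁ w _)    = w
⊢-wf (t-⊕₂ w _)    = w
⊢-wf (t-& w _ _)   = w
⊢-wf (t-! w _ _)   = w
⊢-wf (t-? w _)     = w
⊢-wf (t-W w _)     = w
⊢-wf (t-C w _)     = w

names-⊆ : P ⊩ H → ⊢ P ∷ G → concat H ⊆ map proj₁ (concat G)
names-⊆ (p-exch {G = H} {H′} ⊩P e) ⊢P = ⊆-respˡ-↭ (≈H-concat H H′ e) (names-⊆ ⊩P ⊢P)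
names-⊆ ⊩P (t-exch {G = G} {G′} ⊢P e) =
  ⊆-respʳ-↭ (↭.map⁺ proj₁ (≈H-concat G G′ e)) (names-⊆ ⊩P ⊢P)
names-⊆ (p-ax _) (t-ax _) = ⊆-refl
names-⊆ (p-cut {Γ = Γn} {Δn} {y = y} _ ⊩Q) (t-cut {Γ = Γ} {Δ} _ ⊢Q) =
  ⊆-unbind (Unique-resp-↭ moveₙ (tail u))
    (⊆-respʳ-↭ moveₜ (⊆-respˡ-↭ moveₙ (⊆-unbind u (names-⊆ ⊩Q ⊢Q))))
  where
  u = ⊩-wf ⊩Q
  moveₙ = shift-middle Γn Δn _ y
  moveₜ = ↭.map⁺ proj₁ (shift-middle Γ Δ _ _)
names-⊆ (p-mix {G = H₁} {H₂} _ ⊩P ⊩Q) (t-mix {G = G₁} {G₂} _ ⊢P ⊢Q) =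
  subst₂ _⊆_ (concat-++ H₁ H₂)
    (trans (sym (map-++ proj₁ (concat G₁) (concat G₂))) (cong (map proj₁) (concat-++ G₁ G₂)))
    (⊆.++⁺ (names-⊆ ⊩P ⊢P) (names-⊆ ⊩Q ⊢Q))
names-⊆ p-mix0 t-mix0 = ⊆-refl
names-⊆ (p-⊗ {Γ = Γn} {Δn} {x = x} _ ⊩Q) (t-⊗ {Γ = Γ} {Δ} _ ⊢Q) =
  ⊆-respʳ-↭ moveₜ (⊆-respˡ-↭ moveₙ (⊆-unbind (⊩-wf ⊩Q) (names-⊆ ⊩Q ⊢Q)))
  where
  moveₙ = ↭-trans (shift-middle Γn Δn _ x) (↭-sym (shift-end Γn Δn _ x))
  moveₜ = ↭-trans (↭.map⁺ proj₁ (shift-middle Γ Δ _ _))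
                  (↭.map⁺ proj₁ (↭-sym (shift-end Γ Δ _ _)))
names-⊆ (p-𝟙 _ ⊩Q) (t-𝟙 _ ⊢Q)      = ∷⁺ʳ _ (names-⊆ ⊩Q ⊢Q)
names-⊆ (p-⅋ _ ⊩Q) (t-⅋ _ ⊢Q)      = ⊆-unbind (⊩-wf ⊩Q) (names-⊆ ⊩Q ⊢Q)
names-⊆ (p-⊥ _ ⊩Q) (t-⊥ _ ⊢Q)      = ∷⁺ʳ _ (names-⊆ ⊩Q ⊢Q)
names-⊆ (p-⊕₁ _ ⊩Q) (t-⊕₁ _ ⊢Q)    = names-⊆ ⊩Q ⊢Q
names-⊆ (p-⊕₂ _ ⊩Q) (t-⊕₂ _ ⊢Q)    = names-⊆ ⊩Q ⊢Q
names-⊆ (p-& _ ⊩P _) (t-& _ ⊢P _)  = names-⊆ ⊩P ⊢P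
names-⊆ (p-! _ ⊩Q) (t-! _ _ ⊢Q)    = ∷⁺ʳ _ (⊆-unbind (⊩-wf ⊩Q) (names-⊆ ⊩Q ⊢Q))
names-⊆ (p-? _ ⊩Q) (t-? _ ⊢Q)      = ∷⁺ʳ _ (⊆-unbind (⊩-wf ⊩Q) (names-⊆ ⊩Q ⊢Q))
names-⊆ (p-W _ ⊩Q) (t-W _ ⊢Q)      = ∷⁺ʳ _ (names-⊆ ⊩Q ⊢Q)
names-⊆ (p-C _ ⊩Q) (t-C _ ⊢Q)      =
  ∷⁺ʳ _ (⊆-unbind (tail u) (⊆-unbind u (names-⊆ ⊩Q ⊢Q))) where u = ⊩-wf ⊩Q

Assignment : Set
Assignment = Name → Type

private
  variable
    τ : Assignment

_[_↦_] : Assignment → Name → Type → Assignment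
(τ [ x ↦ A ]) z with z ≟ x
... | yes _ = A
... | no  _ = τ z

[↦]-≡ : ∀ x → (τ [ x ↦ A ]) x ≡ A
[↦]-≡ x with x ≟ x
... | yes _  = refl
... | no x≢x = ⊥-elim (x≢x refl)

[↦]-≢ : x ≢ z → (τ [ x ↦ A ]) z ≡ τ z
[↦]-≢ {x = x} {z} x≢z with z ≟ x
... | yes z≡x = ⊥-elim (x≢z (sym z≡x))
... | no  _   = refl

Agrees : Assignment → Env → Set
Agrees τ = All (λ p → τ (proj₁ p) ≡ proj₂ p)

AgreesH : Assignment → HEnv → Set
AgreesH τ = All (Agrees τ)

agreesH-↭ : concat G ↭ concat G′ → AgreesH τ G → AgreesH τ G′
agreesH-↭ p = concat⁻ ∘ ↭.All-resp-↭ p ∘ concat⁺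

agrees-[↦] : All (x ≢_) (map proj₁ Γ) → Agrees τ Γ → Agrees (τ [ x ↦ A ]) Γ
agrees-[↦] {Γ = []}    []             []        = []
agrees-[↦] {Γ = _ ∷ _} (x≢z ∷ fresh) (τz ∷ ag) = trans ([↦]-≢ x≢z) τz ∷ agrees-[↦] fresh ag

agreesH-[↦] : All (x ≢_) (namesH G) → AgreesH τ G → AgreesH (τ [ x ↦ A ]) G
agreesH-[↦] {G = []}    _     []         = []
agreesH-[↦] {G = Γ ∷ _} fresh (agΓ ∷ ag) =
  agrees-[↦] (++⁻ˡ (map proj₁ Γ) fresh) agΓ ∷ agreesH-[↦] (++⁻ʳ (map proj₁ Γ) fresh) ag

agreesH-bind : All (x ≢_) (namesH (Γ ∷ G)) → AgreesH τ (Γ ∷ G) →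
  AgreesH (τ [ x ↦ A ]) (((x , A) ∷ Γ) ∷ G)
agreesH-bind {x = x} fresh ag with agreesH-[↦] fresh ag
... | agΓ ∷ agG = ([↦]-≡ x ∷ agΓ) ∷ agG

agreesH-bind₂ : WF (((y , A) ∷ (x , B) ∷ Γ) ∷ G) → AgreesH τ (Γ ∷ G) →
  AgreesH (τ [ x ↦ B ] [ y ↦ A ]) (((y , A) ∷ (x , B) ∷ Γ) ∷ G)
agreesH-bind₂ wf ag = agreesH-bind (head wf) (agreesH-bind (head (tail wf)) ag)

agreesH-bind-apart : WF (((x , A) ∷ Γ) ∷ ((y , B) ∷ Δ) ∷ G) → AgreesH τ (Γ ∷ Δ ∷ G) →
  AgreesH (τ [ y ↦ B ] [ x ↦ A ]) (((x , A) ∷ Γ) ∷ ((y , B) ∷ Δ) ∷ G)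
agreesH-bind-apart {y = y} wf ag with agreesH-[↦] (Unique⇒middle-fresh (tail wf)) ag
... | agΓ ∷ agΔ ∷ agG = agreesH-bind (head wf) (agΓ ∷ ([↦]-≡ y ∷ agΔ) ∷ agG)

annotate : Assignment → NEnv → Env
annotate τ = map (λ z → z , τ z)

annotateH : Assignment → NHEnv → HEnv
annotateH τ = map (annotate τ)

infixr 5 _◃_
_◃_ : Name × Type → HEnv → HEnv
p ◃ []      = (p ∷ []) ∷ []
p ◃ (Γ ∷ G) = (p ∷ Γ) ∷ G

strip-annotateH : (τ : Assignment) (H : NHEnv) → strip (annotateH τ H) ≡ H
strip-annotateH τ H = trans (sym (map-∘ H)) (trans (map-cong strip-annotate H) (map-id H))
  where
  strip-annotate : (Γn : NEnv) → map proj₁ (annotate τ Γn) ≡ Γn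
  strip-annotate Γn = trans (sym (map-∘ Γn)) (map-id Γn)

annotateH-wf : WFN H → WF (annotateH τ H)
annotateH-wf {H = H} {τ} = subst (Unique ∘ concat) (sym (strip-annotateH τ H))

annotateH-strip : AgreesH τ G → annotateH τ (strip G) ≡ G
annotateH-strip []         = refl
annotateH-strip (ag ∷ ags) =
  cong₂ _∷_ (trans (sym (map-∘ _)) (map-id-local (All.map (cong (_ ,_)) ag))) (annotateH-strip ags)

annotate-[↦] : All (x ≢_) Γn → annotate (τ [ x ↦ A ]) Γn ≡ annotate τ Γn
annotate-[↦] fresh = map-cong-local (All.map (cong (_ ,_) ∘ [↦]-≢) fresh)

annotateH-[↦] : All (x ≢_) (concat H) → annotateH (τ [ x ↦ A ]) H ≡ annotateH τ H
annotateH-[↦] {H = []}     _     = refl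
annotateH-[↦] {H = Γn ∷ _} fresh =
  cong₂ _∷_ (annotate-[↦] (++⁻ˡ Γn fresh)) (annotateH-[↦] (++⁻ʳ Γn fresh))

annotateH-head : ∀ {τ x A Γn H} → τ x ≡ A →
  annotateH τ ((x ∷ Γn) ∷ H) ≡ (x , A) ◃ annotateH τ (Γn ∷ H)
annotateH-head {τ} {x} {Γn = Γn} {H} = cong (λ A → (x , A) ◃ annotateH τ (Γn ∷ H))

annotateH-bind : All (x ≢_) (concat (Γn ∷ H)) →
  annotateH (τ [ x ↦ A ]) ((x ∷ Γn) ∷ H) ≡ (x , A) ◃ annotateH τ (Γn ∷ H)
annotateH-bind {x = x} fresh = cong₂ (λ A K → (x , A) ◃ K) ([↦]-≡ x) (annotateH-[↦] fresh)

annotateH-bind₂ : WFN ((y ∷ x ∷ Γn) ∷ H) →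
  annotateH (τ [ x ↦ B ] [ y ↦ A ]) ((y ∷ x ∷ Γn) ∷ H) ≡ (y , A) ◃ (x , B) ◃ annotateH τ (Γn ∷ H)
annotateH-bind₂ {y = y} {A = A} w =
  trans (annotateH-bind (head w)) (cong ((y , A) ◃_) (annotateH-bind (head (tail w))))

annotateH-bind-apart : WFN ((x ∷ Γn) ∷ (y ∷ Δn) ∷ H) →
  annotateH (τ [ y ↦ B ] [ x ↦ A ]) ((x ∷ Γn) ∷ (y ∷ Δn) ∷ H)
    ≡ (x , A) ◃ annotate τ Γn ∷ (y , B) ◃ annotateH τ (Δn ∷ H)
annotateH-bind-apart {x = x} {Γn = Γn} {A = A} w =
  trans (annotateH-bind (head w))
    (cong ((x , A) ◃_)
      (cong₂ _∷_ (annotate-[↦] (++⁻ˡ Γn y-fresh)) (annotateH-bind (++⁻ʳ Γn y-fresh))))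
  where
  y-fresh = Unique⇒middle-fresh (tail w)

⊢-subst : G ≡ G′ → ⊢ P ∷ G → ⊢ P ∷ G′
⊢-subst refl ⊢P = ⊢P

by-rule : annotateH τ H ≡ G → WFN H → (WF G → ⊢ P ∷ G) → ⊢ P ∷ annotateH τ H
by-rule {τ = τ} {H = H} refl w rule = rule (annotateH-wf {H = H} {τ = τ} w)

whyNot-annotate : Γn ⊆ map proj₁ Γ → Agrees τ Γ → WhyNotEnv Γ → WhyNotEnv (annotate τ Γn)
whyNot-annotate {τ = τ} Γn⊆Γ ag wn = map⁺ (tabulate (whyNot-type ag wn ∘ Γn⊆Γ))
  where
  whyNot-type : Agrees τ Γ → WhyNotEnv Γ → z ∈ map proj₁ Γ → ∃ λ B → τ z ≡ ⁇ B
  whyNot-type (τz ∷ _) ((B , ⁇B) ∷ _) (here refl) = B , trans τz ⁇B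
  whyNot-type (_ ∷ ag) (_ ∷ wn) (there z∈Γ) = whyNot-type ag wn z∈Γ

retype : P ⊩ H → ⊢ P ∷ G → AgreesH τ G → ⊢ P ∷ annotateH τ H
retype (p-exch {G = H} {H′} ⊩P e) ⊢P ag = t-exch (retype ⊩P ⊢P ag) (≈H-map _ H H′ e)
retype ⊩P (t-exch {G = G} {G′} ⊢P e) ag =
  retype ⊩P ⊢P (agreesH-↭ (↭-sym (≈H-concat G G′ e)) ag)
retype (p-ax w) (t-ax _) ((τx ∷ τy ∷ []) ∷ []) =
  by-rule (cong₂ (λ A B → ((_ , A) ∷ (_ , B) ∷ []) ∷ []) τx τy) w t-ax
retype (p-cut {Γ = Γn} {Δn} w ⊩Q) (t-cut {Γ = Γ} _ ⊢Q) (agΓΔ ∷ agG) =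
  by-rule (cong (_∷ _) (map-++ _ Γn Δn)) w λ wf → t-cut wf
    (⊢-subst (annotateH-bind-apart (⊩-wf ⊩Q))
      (retype ⊩Q ⊢Q (agreesH-bind-apart (⊢-wf ⊢Q) (++⁻ˡ Γ agΓΔ ∷ ++⁻ʳ Γ agΓΔ ∷ agG))))
retype (p-mix {G = H₁} {H₂} w ⊩P ⊩Q) (t-mix {G = G} _ ⊢P ⊢Q) ag =
  by-rule (map-++ _ H₁ H₂) w λ wf →
    t-mix wf (retype ⊩P ⊢P (++⁻ˡ G ag)) (retype ⊩Q ⊢Q (++⁻ʳ G ag))
retype p-mix0 t-mix0 [] = t-mix0
retype {τ = τ} (p-⊗ {Γ = Γn} {Δn} {x} w ⊩Q) (t-⊗ {Γ = Γ} {Δ} {A = A} {B} _ ⊢Q) (agΓΔx ∷ agG)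
  with ++⁻ʳ Γ agΓΔx
... | agΔx with ++⁻ʳ Δ agΔx
... | τx ∷ [] =
  by-rule (cong (_∷ _) conclusion) w λ wf → t-⊗ wf
    (⊢-subst (annotateH-bind-apart (⊩-wf ⊩Q))
      (retype ⊩Q ⊢Q (agreesH-bind-apart (⊢-wf ⊢Q) (++⁻ˡ Γ agΓΔx ∷ ++⁻ˡ Δ agΔx ∷ agG))))
  where
  conclusion : annotate τ (Γn ++ Δn ++ [ x ]) ≡ annotate τ Γn ++ annotate τ Δn ++ [ (x , A ⊗ B) ]
  conclusion = trans (map-++ _ Γn _) (cong (annotate τ Γn ++_)
    (trans (map-++ _ Δn _) (cong (λ T → annotate τ Δn ++ [ (x , T) ]) τx)))
retype (p-𝟙 w ⊩Q) (t-𝟙 _ ⊢Q) ((τx ∷ []) ∷ agG) =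
  by-rule (annotateH-head τx) w λ wf → t-𝟙 wf (retype ⊩Q ⊢Q agG)
retype (p-⅋ w ⊩Q) (t-⅋ _ ⊢Q) ((τx ∷ agΓ) ∷ agG) =
  by-rule (annotateH-head τx) w λ wf → t-⅋ wf
    (⊢-subst (annotateH-bind₂ (⊩-wf ⊩Q)) (retype ⊩Q ⊢Q (agreesH-bind₂ (⊢-wf ⊢Q) (agΓ ∷ agG))))
retype (p-⊥ w ⊩Q) (t-⊥ _ ⊢Q) ((τx ∷ agΓ) ∷ agG) =
  by-rule (annotateH-head τx) w λ wf → t-⊥ wf (retype ⊩Q ⊢Q (agΓ ∷ agG))
retype (p-⊕₁ w ⊩Q) (t-⊕₁ _ ⊢Q) ((τx ∷ agΓ) ∷ agG) =
  by-rule (annotateH-head τx) w λ wf → t-⊕₁ wf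
    (⊢-subst (annotateH-bind (head w)) (retype ⊩Q ⊢Q (agreesH-bind (head (⊢-wf ⊢Q)) (agΓ ∷ agG))))
retype (p-⊕₂ w ⊩Q) (t-⊕₂ _ ⊢Q) ((τx ∷ agΓ) ∷ agG) =
  by-rule (annotateH-head τx) w λ wf → t-⊕₂ wf
    (⊢-subst (annotateH-bind (head w)) (retype ⊩Q ⊢Q (agreesH-bind (head (⊢-wf ⊢Q)) (agΓ ∷ agG))))
retype (p-& w ⊩P ⊩Q) (t-& _ ⊢P ⊢Q) ((τx ∷ agΓ) ∷ []) =
  by-rule (annotateH-head τx) w λ wf → t-& wf
    (⊢-subst (annotateH-bind (head w)) (retype ⊩P ⊢P (agreesH-bind (head (⊢-wf ⊢P)) (agΓ ∷ []))))
    (⊢-subst (annotateH-bind (head w)) (retype ⊩Q ⊢Q (agreesH-bind (head (⊢-wf ⊢Q)) (agΓ ∷ []))))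
retype (p-! w ⊩Q) (t-! _ wn ⊢Q) ((τx ∷ agΓ) ∷ []) =
  by-rule (annotateH-head τx) w λ wf → t-! wf (whyNot-annotate Γn⊆Γ (++⁺ agΓ []) (++⁺ wn []))
    (⊢-subst (annotateH-bind (head u)) (retype ⊩Q ⊢Q (agreesH-bind (head (⊢-wf ⊢Q)) (agΓ ∷ []))))
  where
  u = ⊩-wf ⊩Q
  Γn⊆Γ = ⊆-trans (xs⊆xs++ys _ []) (⊆-unbind u (names-⊆ ⊩Q ⊢Q))
retype (p-? w ⊩Q) (t-? _ ⊢Q) ((τx ∷ agΓ) ∷ agG) =
  by-rule (annotateH-head τx) w λ wf → t-? wf
    (⊢-subst (annotateH-bind (head (⊩-wf ⊩Q)))
      (retype ⊩Q ⊢Q (agreesH-bind (head (⊢-wf ⊢Q)) (agΓ ∷ agG))))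
retype (p-W w ⊩Q) (t-W _ ⊢Q) ((τx ∷ agΓ) ∷ agG) =
  by-rule (annotateH-head τx) w λ wf → t-W wf (retype ⊩Q ⊢Q (agΓ ∷ agG))
retype (p-C w ⊩Q) (t-C _ ⊢Q) ((τx ∷ agΓ) ∷ agG) =
  by-rule (annotateH-head τx) w λ wf → t-C wf
    (⊢-subst (annotateH-bind₂ (⊩-wf ⊩Q)) (retype ⊩Q ⊢Q (agreesH-bind₂ (⊢-wf ⊢Q) (agΓ ∷ agG))))

assignment : Env → Assignment
assignment []            _ = 𝟙
assignment ((x , A) ∷ Γ)   = assignment Γ [ x ↦ A ]

agrees-assignment : Unique (map proj₁ Γ) → Agrees (assignment Γ) Γ
agrees-assignment {Γ = []}          []          = []
agrees-assignment {Γ = (x , _) ∷ _} (fresh ∷ u) = [↦]-≡ x ∷ agrees-[↦] fresh (agrees-assignment u)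

agreesH-⊇ : (∀ {p} → p ∈H G′ → p ∈H G) → AgreesH τ G → AgreesH τ G′
agreesH-⊇ {G′ = G′} G′⊆G ag =
  concat⁻ (tabulate λ p∈G′ → lookup (concat⁺ ag) (∈-concat⁺ (G′⊆G (∈-concat⁻ G′ p∈G′))))

theorem2p4 : (P : Proc) (G G' : HEnv) →
    ⊢ P ∷ G → P ⊩ strip G' → Shuffling G G' → ⊢ P ∷ G'
theorem2p4 P G G' ⊢P ⊩P (_ , same-entries) =
  ⊢-subst (annotateH-strip agrees′) (retype ⊩P ⊢P agrees)
  where
  σ = assignment (concat G)
  agrees : AgreesH σ G
  agrees = concat⁻ (agrees-assignment (subst Unique (concat-map G) (⊢-wf ⊢P)))
  agrees′ : AgreesH σ G'
  agrees′ = agreesH-⊇ (λ {(x , A)} → Equivalence.from (same-entries x A)) agrees
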